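{- Let $B$ be a Young diagram in an $\ell\times r$ frame and let $P\in B$ be such that the transpose of $B$ at $P$ is legal. Then $m_k(B^*_P)=m_k(B)$ for every $k\ge 0$.
   Context: A Young diagram in an $\ell\times r$ frame is a subset $B\subseteq[\ell]\times[r]$ such that whenever $(i,j)\in B$ with $i>1$ then $(i-1,j)\in B$, and whenever $(i,j)\in B$ with $j>1$ then $(i,j-1)\in B$. A matching in $B$ is a subset of $B$ no two of whose elements share a row or a column; $m_k(B)$ is the number of matchings of size $k$. For $P=(i,j)\in B$, the transpose of $B$ at $P$ is $$B^*_P=\{(a,b)\in B: a<i\text{ or }b<j\}\cup\{(b-j+i,\ a-i+j): (a,b)\in B,\ a\ge i,\ b\ge j\}.$$ The transpose at $P$ is called legal if $B^*_P$ is a Young diagram in the $\ell\times r$ frame. -}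

module Defs where

open import Data.Nat using (ℕ; zero; suc; _+_; _∸_; _≤_; _<_; _≡ᵇ_; _<ᵇ_)
open import Data.Bool using (Bool; true; false; _∧_; _∨_; not; if_then_else_)
open import Data.List using (List; []; _∷_; length; filter; map; concatMap)
open import Data.Product using (_×_; _,_)
open import Relation.Binary.PropositionalEquality using (_≡_)
open import Relation.Nullary.Decidable using (does)
open import Relation.Unary using (Decidable)
import Data.Bool.Properties as BP

-- A subset of ℕ × ℕ (cells (row , column), 1-indexed) given by a
-- decidable (Boolean) membership predicate.
Cells : Set
Cells = ℕ → ℕ → Bool

record IsYoung (ℓ r : ℕ) (B : Cells) : Set where
  field
    inFrame : ∀ i j → B i j ≡ true → (1 ≤ i) × (i ≤ ℓ) × (1 ≤ j) × (j ≤ r)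
    upClosed : ∀ i j → B (suc (suc i)) j ≡ true → B (suc i) j ≡ true
    leftClosed : ∀ i j → B i (suc (suc j)) ≡ true → B i (suc j) ≡ true

range : ℕ → List ℕ
range zero = []
range (suc n) = range n Data.List.++ (suc n ∷ [])

cellList : ℕ → ℕ → Cells → List (ℕ × ℕ)
cellList ℓ r B =
  filter (λ p → BP.T? (B (Data.Product.proj₁ p) (Data.Product.proj₂ p)))
         (concatMap (λ a → map (λ b → (a , b)) (range r)) (range ℓ))

-- all sublists (= all subsets of a repetition-free list)
sublists : {A : Set} → List A → List (List A)
sublists [] = [] ∷ []
sublists (x ∷ xs) = sublists xs Data.List.++ map (x ∷_) (sublists xs)

disjointRC : ℕ × ℕ → ℕ × ℕ → Bool
disjointRC (a , b) (c , d) = not (a ≡ᵇ c) ∧ not (b ≡ᵇ d)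

allB : {A : Set} → (A → Bool) → List A → Bool
allB p [] = true
allB p (x ∷ xs) = p x ∧ allB p xs

isMatching : List (ℕ × ℕ) → Bool
isMatching [] = true
isMatching (x ∷ xs) = allB (disjointRC x) xs ∧ isMatching xs

matchCount : ℕ → ℕ → Cells → ℕ → ℕ
matchCount ℓ r B k =
  length (filter (λ S → BP.T? ((length S ≡ᵇ k) ∧ isMatching S)) (sublists (cellList ℓ r B)))

-- transpose of B at P = (i , j):
--   B*_P = {(a,b) ∈ B : a < i or b < j}
--        ∪ {(b - j + i , a - i + j) : (a,b) ∈ B, a ≥ i, b ≥ j}.
-- A cell (x , y) lies in the second set iff x ≥ i, y ≥ j and
-- (y - i + j , x - j + i) ∈ B  (the unique preimage); elements of the
-- second set always have x ≥ i and y ≥ j.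
transposeAt : Cells → ℕ → ℕ → Cells
transposeAt B i j x y =
  (B x y ∧ ((x <ᵇ i) ∨ (y <ᵇ j)))
  ∨ (not (x <ᵇ i) ∧ not (y <ᵇ j) ∧ B (y ∸ j + i) (x ∸ i + j))

LegalTranspose : ℕ → ℕ → Cells → ℕ → ℕ → Set
LegalTranspose ℓ r B i j = IsYoung ℓ r (transposeAt B i j)

module Submission where

-- The count of k-matchings of a duplicate-free list of cells depends only on
-- its set of cells, and is invariant under maps preserving the relation
-- "shares neither a row nor a column".  Removing the first row (or column)
-- of a quadrant Q of a Young diagram gives the rook recurrence
--   m_{k+1}(Q) = m_{k+1}(Q') + (n - k) m_k(Q'),
-- n the length of the line and Q' the next quadrant: the line covers every
-- column (row) of Q', so each k-matching of Q' extends by n - k of its cells.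
-- B and B*_P agree outside the corner {rows ≥ i, columns ≥ j}, whose image
-- under the transpose is its reflection, so the corners have equal counts.
-- Peeling off the columns j-1, …, 1 of the rows ≥ i and then the rows
-- i-1, …, 1 with the rook recurrence (both diagrams being Young) transfers
-- the equality to the whole diagrams.

open import Defs
open import Data.Nat using (ℕ; zero; suc; _+_; _*_; _∸_; _≤_; _<_; _≡ᵇ_; z≤n; s≤s; _≟_; _≤?_; _≤′_; ≤′-refl; ≤′-reflexive; ≤′-step; _<ᵇ_)
open import Data.Nat.Properties
  using (+-comm; +-assoc; +-identityʳ; *-identityʳ; *-zeroʳ; *-distribˡ-+; ∸-+-assoc; ≡ᵇ⇒≡; ≡⇒≡ᵇ;
         m≤n⇒m≤1+n; ≤-refl; ≤-trans; ≤-pred; ≤∧≢⇒<; <⇒≤; <⇒≢; 1+n≰n; ≤⇒≤′;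
         m+[n∸m]≡n; m<m+n; +-suc; <⇒<ᵇ; <ᵇ⇒<; <⇒≱; m+n∸n≡m; m∸n+n≡m; m≤n+m)
open import Data.Nat.Tactic.RingSolver using (solve-∀)
open import Data.Bool using (Bool; true; false; _∧_; not; if_then_else_; T; T?)
open import Data.Bool.Properties
  using (∧-comm; T-≡; T-not-≡; T-∧; ∨-identityʳ; ∧-identityʳ; ∨-zeroʳ; ∧-zeroʳ)
open import Data.List using (List; []; _∷_; _++_; length; map; filter; filterᵇ; concatMap)
open import Data.List.Properties using (length-++; length-map; filter-++; filter-all; filter-none)
open import Data.List.Membership.Propositional using (_∈_; find; lose)
open import Data.List.Membership.Propositional.Properties
  using (∈-filter⁻; ∈-filter⁺; ∈-map⁺; ∈-map⁻; ∈-++⁻; ∈-++⁺ˡ; ∈-++⁺ʳ; ∈-concatMap⁺; ∈-concatMap⁻)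
open import Data.List.Membership.Propositional.Properties.WithK using (unique∧set⇒bag)
open import Data.List.Relation.Unary.Any using (here; there)
open import Data.List.Relation.Unary.Unique.Propositional using (Unique)
open import Data.List.Relation.Unary.Unique.Propositional.Properties using (filter⁺; ++⁺)
import Data.List.Relation.Unary.Unique.Propositional.Properties as Unique
import Data.List.Relation.Unary.AllPairs as AllPairs
import Data.List.Relation.Unary.All as All
import Data.List.Relation.Unary.All.Properties as All
open import Data.List.Relation.Binary.BagAndSetEquality using (∼bag⇒↭)
open import Data.List.Relation.Binary.Permutation.Propositional as Perm using (_↭_; ↭-sym)
open import Data.List.Relation.Binary.Permutation.Propositional.Properties using (shift; filter-↭; ↭-length)
open import Data.Product using (_×_; _,_; proj₁; proj₂; swap)
open import Function using (_∘_; _⇔_; Equivalence; mk⇔)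
open import Data.Empty using (⊥-elim)
open import Data.Sum using (inj₁; inj₂)
open import Relation.Nullary using (¬_; yes; no; does; ¬?; _×-dec_)
open import Relation.Unary using (Decidable)
open import Relation.Binary.PropositionalEquality
  using (_≡_; refl; sym; trans; cong; cong₂; subst; module ≡-Reasoning)

↭-partition : ∀ {A : Set} {P : A → Set} (P? : Decidable P) (xs : List A) →
  xs ↭ filter P? xs ++ filter (¬? ∘ P?) xs
↭-partition P? [] = Perm.refl
↭-partition P? (x ∷ xs) with does (P? x)
... | true = Perm.prep x (↭-partition P? xs)
... | false = Perm.trans (Perm.prep x (↭-partition P? xs))
                         (↭-sym (shift x (filter P? xs) _))

filter-map : ∀ {A B : Set} {P : B → Set} (P? : Decidable P) (g : A → B) (xs : List A) →
  filter P? (map g xs) ≡ map g (filter (P? ∘ g) xs)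
filter-map P? g [] = refl
filter-map P? g (x ∷ xs) with does (P? (g x))
... | true = cong (g x ∷_) (filter-map P? g xs)
... | false = filter-map P? g xs

filter-comm : ∀ {A : Set} {P Q : A → Set} (P? : Decidable P) (Q? : Decidable Q) (xs : List A) →
  filter P? (filter Q? xs) ≡ filter Q? (filter P? xs)
filter-comm P? Q? [] = refl
filter-comm P? Q? (x ∷ xs) with does (P? x) in p | does (Q? x) in q
... | true | true rewrite p | q = cong (x ∷_) (filter-comm P? Q? xs)
... | true | false rewrite q = filter-comm P? Q? xs
... | false | true rewrite p = filter-comm P? Q? xs
... | false | false = filter-comm P? Q? xs

filterᵇ-cong : ∀ {A : Set} {p q : A → Bool} (xs : List A) →
  (∀ x → x ∈ xs → p x ≡ q x) → filterᵇ p xs ≡ filterᵇ q xs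
filterᵇ-cong [] e = refl
filterᵇ-cong {p = p} {q} (x ∷ xs) e with p x | q x | e x (here refl)
... | true | true | refl = cong (x ∷_) (filterᵇ-cong xs (λ y m → e y (there m)))
... | false | false | refl = filterᵇ-cong xs (λ y m → e y (there m))

unique-map : ∀ {A B : Set} (f : A → B) {xs : List A} →
  (∀ {x y} → x ∈ xs → y ∈ xs → f x ≡ f y → x ≡ y) → Unique xs → Unique (map f xs)
unique-map f inj AllPairs.[] = AllPairs.[]
unique-map f inj (x∉ AllPairs.∷ u) =
  All.map⁺ (All.tabulate (λ y∈ fx≡fy → All.lookup x∉ y∈ (inj (here refl) (there y∈) fx≡fy)))
  AllPairs.∷ unique-map f (λ x∈ y∈ → inj (there x∈) (there y∈)) u

sameElements⇒↭ : ∀ {A : Set} {xs ys : List A} → Unique xs → Unique ys →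
  (∀ {z} → z ∈ xs ⇔ z ∈ ys) → xs ↭ ys
sameElements⇒↭ uxs uys same = ∼bag⇒↭ (unique∧set⇒bag uxs uys same)

∧-exchange : ∀ a b c → a ∧ (b ∧ c) ≡ b ∧ (a ∧ c)
∧-exchange true b c = refl
∧-exchange false true c = refl
∧-exchange false false c = refl

≡ᵇ-sym : ∀ m n → (m ≡ᵇ n) ≡ (n ≡ᵇ m)
≡ᵇ-sym zero zero = refl
≡ᵇ-sym zero (suc n) = refl
≡ᵇ-sym (suc m) zero = refl
≡ᵇ-sym (suc m) (suc n) = ≡ᵇ-sym m n

≡ᵇ-true : ∀ {m n} → m ≡ n → (m ≡ᵇ n) ≡ true
≡ᵇ-true {m} refl = Equivalence.to T-≡ (≡⇒≡ᵇ m m refl)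

≡ᵇ-false : ∀ {m n} → ¬ m ≡ n → (m ≡ᵇ n) ≡ false
≡ᵇ-false {m} {n} m≢n with m ≡ᵇ n in m≡ᵇn
... | false = refl
... | true = ⊥-elim (m≢n (≡ᵇ⇒≡ m n (Equivalence.from T-≡ m≡ᵇn)))

<ᵇ-true : ∀ {a i} → a < i → (a <ᵇ i) ≡ true
<ᵇ-true a<i = Equivalence.to T-≡ (<⇒<ᵇ a<i)

<ᵇ-false : ∀ {a i} → i ≤ a → (a <ᵇ i) ≡ false
<ᵇ-false {a} {i} i≤a with a <ᵇ i in a<ᵇi
... | false = refl
... | true = ⊥-elim (<⇒≱ (<ᵇ⇒< a i (Equivalence.from T-≡ a<ᵇi)) i≤a)

≡ᵇ-injective : ∀ (f : ℕ → ℕ) {a b} → (f a ≡ f b → a ≡ b) → (f a ≡ᵇ f b) ≡ (a ≡ᵇ b)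
≡ᵇ-injective f {a} {b} inj with a ≟ b
... | yes refl = trans (≡ᵇ-true (refl {x = f a})) (sym (≡ᵇ-true (refl {x = a})))
... | no a≢b = trans (≡ᵇ-false (a≢b ∘ inj)) (sym (≡ᵇ-false a≢b))

downwardInduction : ∀ (P : ℕ → Set) n → P n → (∀ m → 1 ≤ m → m < n → P (suc m) → P m) →
  ∀ m → 1 ≤ m → m ≤ n → P m
downwardInduction P n Pn step m 1≤m m≤n = go (n ∸ m) m 1≤m (m+[n∸m]≡n m≤n)
  where
  go : ∀ d m → 1 ≤ m → m + d ≡ n → P m
  go zero m _ m+0≡n = subst P (sym (trans (sym (+-identityʳ m)) m+0≡n)) Pn
  go (suc d) m 1≤m m+d+1≡n =
    step m 1≤m (subst (m <_) m+d+1≡n (m<m+n m (s≤s z≤n)))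
         (go d (suc m) (s≤s z≤n) (trans (sym (+-suc m d)) m+d+1≡n))

countSublists : ∀ {A : Set} → (List A → Bool) → List A → ℕ
countSublists p xs = length (filterᵇ p (sublists xs))

countSublists-∷ : ∀ {A : Set} (p : List A → Bool) x xs →
  countSublists p (x ∷ xs) ≡ countSublists p xs + countSublists (p ∘ (x ∷_)) xs
countSublists-∷ p x xs = begin
  length (filterᵇ p (sublists xs ++ map (x ∷_) (sublists xs)))
    ≡⟨ cong length (filter-++ _ (sublists xs) _) ⟩
  length (filterᵇ p (sublists xs) ++ filterᵇ p (map (x ∷_) (sublists xs)))
    ≡⟨ length-++ (filterᵇ p (sublists xs)) ⟩
  countSublists p xs + length (filterᵇ p (map (x ∷_) (sublists xs)))
    ≡⟨ cong (λ L → countSublists p xs + length L) (filter-map (T? ∘ p) (x ∷_) (sublists xs)) ⟩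
  countSublists p xs + length (map (x ∷_) (filterᵇ (p ∘ (x ∷_)) (sublists xs)))
    ≡⟨ cong (countSublists p xs +_) (length-map (x ∷_) (filterᵇ (p ∘ (x ∷_)) (sublists xs))) ⟩
  countSublists p xs + countSublists (p ∘ (x ∷_)) xs ∎
  where open ≡-Reasoning

countSublists-cong : ∀ {A : Set} {p q : List A → Bool} (xs : List A) →
  (∀ S → p S ≡ q S) → countSublists p xs ≡ countSublists q xs
countSublists-cong xs e = cong length (filterᵇ-cong (sublists xs) (λ S _ → e S))

countSublists-none : ∀ {A : Set} (xs : List A) → countSublists (λ _ → false) xs ≡ 0
countSublists-none [] = refl
countSublists-none (x ∷ xs) =
  trans (countSublists-∷ _ x xs) (cong₂ _+_ (countSublists-none xs) (countSublists-none xs))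

countSublists-allB : ∀ {A : Set} (Q : List A → Bool) (q : A → Bool) (xs : List A) →
  countSublists (λ S → allB q S ∧ Q S) xs ≡ countSublists Q (filterᵇ q xs)
countSublists-allB Q q [] with Q []
... | true = refl
... | false = refl
countSublists-allB Q q (x ∷ xs) =
  trans (countSublists-∷ _ x xs) (trans (cong (_+ countSublists (λ S → (q x ∧ allB q S) ∧ Q (x ∷ S)) xs)
                                      (countSublists-allB Q q xs)) headCase)
  where
  headCase : countSublists Q (filterᵇ q xs) + countSublists (λ S → (q x ∧ allB q S) ∧ Q (x ∷ S)) xs
           ≡ countSublists Q (filterᵇ q (x ∷ xs))
  headCase with q x
  ... | true = begin
    countSublists Q (filterᵇ q xs) + countSublists (λ S → allB q S ∧ Q (x ∷ S)) xs
      ≡⟨ cong (countSublists Q (filterᵇ q xs) +_) (countSublists-allB (Q ∘ (x ∷_)) q xs) ⟩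
    countSublists Q (filterᵇ q xs) + countSublists (Q ∘ (x ∷_)) (filterᵇ q xs)
      ≡⟨ sym (countSublists-∷ Q x (filterᵇ q xs)) ⟩
    countSublists Q (x ∷ filterᵇ q xs) ∎
    where open ≡-Reasoning
  ... | false = trans (cong (countSublists Q (filterᵇ q xs) +_) (countSublists-none xs)) (+-identityʳ _)

Cell : Set
Cell = ℕ × ℕ

row col : Cell → ℕ
row = proj₁
col = proj₂

sizedMatching : ℕ → List Cell → Bool
sizedMatching k S = (length S ≡ᵇ k) ∧ isMatching S

matchings : List Cell → ℕ → ℕ
matchings L k = countSublists (sizedMatching k) L

compatibleWith : Cell → List Cell → List Cell
compatibleWith x = filterᵇ (disjointRC x)

matchings-zero : ∀ L → matchings L 0 ≡ 1
matchings-zero [] = refl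
matchings-zero (x ∷ L) =
  trans (countSublists-∷ _ x L) (cong₂ _+_ (matchings-zero L) (countSublists-none L))

matchings-zero-eq : ∀ L L' → matchings L 0 ≡ matchings L' 0
matchings-zero-eq L L' = trans (matchings-zero L) (sym (matchings-zero L'))

matchings-∷ : ∀ x L k →
  matchings (x ∷ L) (suc k) ≡ matchings L (suc k) + matchings (compatibleWith x L) k
matchings-∷ x L k = trans (countSublists-∷ _ x L) (cong (matchings L (suc k) +_) (begin
  countSublists (λ S → (length S ≡ᵇ k) ∧ (allB (disjointRC x) S ∧ isMatching S)) L
    ≡⟨ countSublists-cong L (λ S → ∧-exchange (length S ≡ᵇ k) (allB (disjointRC x) S) _) ⟩
  countSublists (λ S → allB (disjointRC x) S ∧ sizedMatching k S) L
    ≡⟨ countSublists-allB (sizedMatching k) (disjointRC x) L ⟩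
  matchings (compatibleWith x L) k ∎))
  where open ≡-Reasoning

disjointRC-sym : ∀ x y → disjointRC x y ≡ disjointRC y x
disjointRC-sym (a , b) (c , d) = cong₂ (λ s t → not s ∧ not t) (≡ᵇ-sym a c) (≡ᵇ-sym b d)

compatibleWith-accept : ∀ {x y} L → disjointRC x y ≡ true →
  compatibleWith x (y ∷ L) ≡ y ∷ compatibleWith x L
compatibleWith-accept L e rewrite e = refl

compatibleWith-reject : ∀ {x y} L → disjointRC x y ≡ false →
  compatibleWith x (y ∷ L) ≡ compatibleWith x L
compatibleWith-reject L e rewrite e = refl

matchings-∷∷ : ∀ x y L k → matchings (x ∷ y ∷ L) (suc k) ≡
  matchings L (suc k) + (matchings (compatibleWith y L) k + matchings (compatibleWith x (y ∷ L)) k)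
matchings-∷∷ x y L k = begin
  matchings (x ∷ y ∷ L) (suc k)
    ≡⟨ matchings-∷ x (y ∷ L) k ⟩
  matchings (y ∷ L) (suc k) + matchings (compatibleWith x (y ∷ L)) k
    ≡⟨ cong (_+ matchings (compatibleWith x (y ∷ L)) k) (matchings-∷ y L k) ⟩
  matchings L (suc k) + matchings (compatibleWith y L) k + matchings (compatibleWith x (y ∷ L)) k
    ≡⟨ +-assoc (matchings L (suc k)) _ _ ⟩
  matchings L (suc k) + (matchings (compatibleWith y L) k + matchings (compatibleWith x (y ∷ L)) k) ∎
  where open ≡-Reasoning

-- The part of the expansion involving x or y is symmetric in x and y:
-- if x and y are compatible, both sides count the matchings containing
-- exactly one of them and those containing both.
matchings-crossTerms : ∀ x y L k →
  matchings (compatibleWith y L) k + matchings (compatibleWith x (y ∷ L)) k ≡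
  matchings (compatibleWith x L) k + matchings (compatibleWith y (x ∷ L)) k
matchings-crossTerms x y L k with disjointRC x y in xy
... | false rewrite compatibleWith-reject {y} {x} L (trans (disjointRC-sym y x) xy) =
  +-comm (matchings (compatibleWith y L) k) _
... | true rewrite compatibleWith-accept {y} {x} L (trans (disjointRC-sym y x) xy) = both k
  where
  both : ∀ k → matchings (compatibleWith y L) k + matchings (y ∷ compatibleWith x L) k ≡
               matchings (compatibleWith x L) k + matchings (x ∷ compatibleWith y L) k
  both zero = cong₂ _+_ (matchings-zero-eq (compatibleWith y L) (compatibleWith x L))
                        (matchings-zero-eq (y ∷ compatibleWith x L) (x ∷ compatibleWith y L))
  both (suc k) rewrite matchings-∷ y (compatibleWith x L) k
                     | matchings-∷ x (compatibleWith y L) k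
                     | filter-comm (T? ∘ disjointRC x) (T? ∘ disjointRC y) L =
    shuffle (matchings (compatibleWith y L) (suc k)) (matchings (compatibleWith x L) (suc k)) _
    where
    shuffle : ∀ a b c → a + (b + c) ≡ b + (a + c)
    shuffle = solve-∀

matchings-exchange : ∀ x y L k → matchings (x ∷ y ∷ L) k ≡ matchings (y ∷ x ∷ L) k
matchings-exchange x y L zero = matchings-zero-eq (x ∷ y ∷ L) (y ∷ x ∷ L)
matchings-exchange x y L (suc k) =
  trans (matchings-∷∷ x y L k)
        (trans (cong (matchings L (suc k) +_) (matchings-crossTerms x y L k))
               (sym (matchings-∷∷ y x L k)))

matchings-∷-cong : ∀ x L L' k → matchings L (suc k) ≡ matchings L' (suc k) →
  matchings (compatibleWith x L) k ≡ matchings (compatibleWith x L') k →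
  matchings (x ∷ L) (suc k) ≡ matchings (x ∷ L') (suc k)
matchings-∷-cong x L L' k same sameCompat =
  trans (matchings-∷ x L k) (trans (cong₂ _+_ same sameCompat) (sym (matchings-∷ x L' k)))

matchings-↭ : ∀ {L L'} → L ↭ L' → ∀ k → matchings L k ≡ matchings L' k
matchings-↭ {L} {L'} p zero = matchings-zero-eq L L'
matchings-↭ Perm.refl (suc k) = refl
matchings-↭ (Perm.prep {xs} {ys} x p) (suc k) =
  matchings-∷-cong x xs ys k (matchings-↭ p (suc k))
                             (matchings-↭ (filter-↭ (T? ∘ disjointRC x) p) k)
matchings-↭ (Perm.swap {xs} {ys} x y p) (suc k) =
  trans (matchings-exchange x y xs (suc k))
        (matchings-∷-cong y (x ∷ xs) (x ∷ ys) k
          (matchings-∷-cong x xs ys k (matchings-↭ p (suc k))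
                                      (matchings-↭ (filter-↭ (T? ∘ disjointRC x) p) k))
          (matchings-↭ (filter-↭ (T? ∘ disjointRC y) (Perm.prep x p)) k))
matchings-↭ (Perm.trans p q) (suc k) = trans (matchings-↭ p (suc k)) (matchings-↭ q (suc k))

matchings-sameElements : ∀ {L L'} → Unique L → Unique L' → (∀ {z} → z ∈ L ⇔ z ∈ L') →
  ∀ k → matchings L k ≡ matchings L' k
matchings-sameElements uL uL' same = matchings-↭ (sameElements⇒↭ uL uL' same)

PreservesDisjointness : (Cell → Cell) → List Cell → Set
PreservesDisjointness f L = ∀ {x y} → x ∈ L → y ∈ L → disjointRC (f x) (f y) ≡ disjointRC x y

matchings-map : ∀ f L → PreservesDisjointness f L → ∀ k → matchings (map f L) k ≡ matchings L k
matchings-map f L pres zero = matchings-zero-eq (map f L) L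
matchings-map f [] pres (suc k) = refl
matchings-map f (y ∷ L) pres (suc k) = begin
  matchings (f y ∷ map f L) (suc k)
    ≡⟨ matchings-∷ (f y) (map f L) k ⟩
  matchings (map f L) (suc k) + matchings (compatibleWith (f y) (map f L)) k
    ≡⟨ cong (λ M → matchings (map f L) (suc k) + matchings M k) compatible-map ⟩
  matchings (map f L) (suc k) + matchings (map f (compatibleWith y L)) k
    ≡⟨ cong₂ _+_ (matchings-map f L (pres ∘₂ there) (suc k))
                 (matchings-map f (compatibleWith y L) (pres ∘₂ (there ∘ filtered)) k) ⟩
  matchings L (suc k) + matchings (compatibleWith y L) k
    ≡⟨ sym (matchings-∷ y L k) ⟩
  matchings (y ∷ L) (suc k) ∎
  where
  open ≡-Reasoning
  _∘₂_ : ∀ {M N : List Cell} → PreservesDisjointness f M → (∀ {z} → z ∈ N → z ∈ M) → PreservesDisjointness f N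
  (h ∘₂ incl) x∈ y∈ = h (incl x∈) (incl y∈)
  filtered : ∀ {z} → z ∈ compatibleWith y L → z ∈ L
  filtered z∈ = proj₁ (∈-filter⁻ (T? ∘ disjointRC y) z∈)
  compatible-map : compatibleWith (f y) (map f L) ≡ map f (compatibleWith y L)
  compatible-map = trans (filter-map (T? ∘ disjointRC (f y)) f L)
    (cong (map f) (filterᵇ-cong L (λ z z∈ → pres (here refl) (there z∈))))

dropColumn : ℕ → List Cell → List Cell
dropColumn c = filterᵇ (λ z → not (col z ≡ᵇ c))

without : ℕ → List ℕ → List ℕ
without c = filterᵇ (λ b → not (c ≡ᵇ b))

sumOver : List ℕ → (ℕ → ℕ) → ℕ
sumOver [] g = 0
sumOver (c ∷ C) g = g c + sumOver C g

sumOver-cong : ∀ C {g h : ℕ → ℕ} → (∀ c → g c ≡ h c) → sumOver C g ≡ sumOver C h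
sumOver-cong [] e = refl
sumOver-cong (c ∷ C) e = cong₂ _+_ (e c) (sumOver-cong C e)

sumOver-+ : ∀ C g h → sumOver C (λ c → g c + h c) ≡ sumOver C g + sumOver C h
sumOver-+ [] g h = refl
sumOver-+ (c ∷ C) g h rewrite sumOver-+ C g h = shuffle (g c) (h c) (sumOver C g) (sumOver C h)
  where
  shuffle : ∀ a b s t → a + b + (s + t) ≡ a + s + (b + t)
  shuffle = solve-∀

sumOver-ones : ∀ C → sumOver C (λ _ → 1) ≡ length C
sumOver-ones [] = refl
sumOver-ones (c ∷ C) = cong suc (sumOver-ones C)

sumOver-zeros : ∀ C → sumOver C (λ _ → 0) ≡ 0
sumOver-zeros [] = refl
sumOver-zeros (c ∷ C) = sumOver-zeros C

sumOver-without : ∀ c₀ C h →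
  sumOver C (λ c → if c₀ ≡ᵇ c then 0 else h c) ≡ sumOver (without c₀ C) h
sumOver-without c₀ [] h = refl
sumOver-without c₀ (c ∷ C) h with c₀ ≡ᵇ c
... | true = sumOver-without c₀ C h
... | false = cong (h c +_) (sumOver-without c₀ C h)

length-without : ∀ {c₀} C → c₀ ∈ C → Unique C → length (without c₀ C) ≡ length C ∸ 1
length-without {c₀} (c ∷ C) (here refl) (c₀∉C AllPairs.∷ _) rewrite ≡ᵇ-true (refl {x = c₀}) =
  cong length (filter-all (T? ∘ λ b → not (c₀ ≡ᵇ b))
                          (All.map (λ c₀≢b → Equivalence.from T-not-≡ (≡ᵇ-false c₀≢b)) c₀∉C))
length-without {c₀} (c ∷ C) (there c₀∈C) (c∉C AllPairs.∷ u)
  rewrite ≡ᵇ-false (λ c₀≡c → All.lookup c∉C c₀∈C (sym c₀≡c)) =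
  trans (cong suc (length-without C c₀∈C u)) (nonEmpty c₀∈C)
  where
  nonEmpty : ∀ {D : List ℕ} → c₀ ∈ D → suc (length D ∸ 1) ≡ length D
  nonEmpty {_ ∷ _} _ = refl

dropColumn-compatibleWith : ∀ c y L →
  compatibleWith y (dropColumn c L) ≡ dropColumn c (compatibleWith y L)
dropColumn-compatibleWith c y L = filter-comm (T? ∘ disjointRC y) (T? ∘ λ z → not (col z ≡ᵇ c)) L

matchings-dropColumn-∷ : ∀ c y L k →
  matchings (dropColumn c (y ∷ L)) (suc k) ≡
  matchings (dropColumn c L) (suc k) +
  (if col y ≡ᵇ c then 0 else matchings (dropColumn c (compatibleWith y L)) k)
matchings-dropColumn-∷ c y L k with col y ≡ᵇ c
... | true = sym (+-identityʳ _)
... | false = trans (matchings-∷ y (dropColumn c L) k)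
  (cong (λ M → matchings (dropColumn c L) (suc k) + matchings M k) (dropColumn-compatibleWith c y L))

-- Double counting: if the columns of all cells of L lie in the
-- duplicate-free list C, every k-matching of L avoids exactly |C| - k of
-- those columns, so summing over c ∈ C the k-matchings avoiding column c
-- counts every k-matching |C| - k times.
sumOver-dropColumn : ∀ C L k → Unique C → (∀ {z} → z ∈ L → col z ∈ C) →
  sumOver C (λ c → matchings (dropColumn c L) k) ≡ (length C ∸ k) * matchings L k
sumOver-dropColumn C L zero uC cols = begin
  sumOver C (λ c → matchings (dropColumn c L) 0)  ≡⟨ sumOver-cong C (λ c → matchings-zero (dropColumn c L)) ⟩
  sumOver C (λ _ → 1)                             ≡⟨ sumOver-ones C ⟩
  length C                                         ≡⟨ sym (*-identityʳ (length C)) ⟩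
  length C * 1                                     ≡⟨ cong (length C *_) (sym (matchings-zero L)) ⟩
  length C * matchings L 0 ∎
  where open ≡-Reasoning
sumOver-dropColumn C [] (suc k) uC cols = trans (sumOver-zeros C) (sym (*-zeroʳ (length C ∸ suc k)))
sumOver-dropColumn C (y ∷ L) (suc k) uC cols = begin
  sumOver C (λ c → matchings (dropColumn c (y ∷ L)) (suc k))
    ≡⟨ sumOver-cong C (λ c → matchings-dropColumn-∷ c y L k) ⟩
  sumOver C (λ c → matchings (dropColumn c L) (suc k) + (if col y ≡ᵇ c then 0 else N c))
    ≡⟨ sumOver-+ C _ _ ⟩
  sumOver C (λ c → matchings (dropColumn c L) (suc k)) + sumOver C (λ c → if col y ≡ᵇ c then 0 else N c)
    ≡⟨ cong₂ _+_ (sumOver-dropColumn C L (suc k) uC (cols ∘ there)) (sumOver-without (col y) C N) ⟩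
  n * matchings L (suc k) + sumOver C' N
    ≡⟨ cong (n * matchings L (suc k) +_) (sumOver-dropColumn C' L' k (filter⁺ _ uC) cols') ⟩
  n * matchings L (suc k) + (length C' ∸ k) * matchings L' k
    ≡⟨ cong (λ m → n * matchings L (suc k) + (m ∸ k) * matchings L' k) (length-without C (cols (here refl)) uC) ⟩
  n * matchings L (suc k) + (length C ∸ 1 ∸ k) * matchings L' k
    ≡⟨ cong (λ m → n * matchings L (suc k) + m * matchings L' k) (∸-+-assoc (length C) 1 k) ⟩
  n * matchings L (suc k) + n * matchings L' k
    ≡⟨ sym (*-distribˡ-+ n _ _) ⟩
  n * (matchings L (suc k) + matchings L' k)
    ≡⟨ cong (n *_) (sym (matchings-∷ y L k)) ⟩
  n * matchings (y ∷ L) (suc k) ∎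
  where
  open ≡-Reasoning
  n = length C ∸ suc k
  L' = compatibleWith y L
  C' = without (col y) C
  N : ℕ → ℕ
  N c = matchings (dropColumn c L') k
  cols' : ∀ {z} → z ∈ L' → col z ∈ C'
  cols' z∈ with ∈-filter⁻ (T? ∘ disjointRC y) z∈
  ... | z∈L , compatible =
    ∈-filter⁺ (T? ∘ λ b → not (col y ≡ᵇ b)) (cols (there z∈L)) (proj₂ (Equivalence.to T-∧ compatible))

-- If all cells of A lie in row x and no cell of Rest does, then a
-- (k+1)-matching of A ++ Rest uses at most one cell a ∈ A, and the other
-- cells form a k-matching of Rest avoiding the column of a.
matchings-peelRow : ∀ x A Rest k → (∀ {a} → a ∈ A → row a ≡ x) → (∀ {z} → z ∈ Rest → ¬ row z ≡ x) →
  matchings (A ++ Rest) (suc k) ≡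
  matchings Rest (suc k) + sumOver (map col A) (λ c → matchings (dropColumn c Rest) k)
matchings-peelRow x [] Rest k inRow offRow = sym (+-identityʳ _)
matchings-peelRow x (a ∷ A) Rest k inRow offRow = begin
  matchings (a ∷ A ++ Rest) (suc k)
    ≡⟨ matchings-∷ a (A ++ Rest) k ⟩
  matchings (A ++ Rest) (suc k) + matchings (compatibleWith a (A ++ Rest)) k
    ≡⟨ cong₂ _+_ (matchings-peelRow x A Rest k (inRow ∘ there) offRow)
                 (cong (λ M → matchings M k) compatible-a) ⟩
  matchings Rest (suc k) + S + matchings (dropColumn (col a) Rest) k
    ≡⟨ +-assoc (matchings Rest (suc k)) S _ ⟩
  matchings Rest (suc k) + (S + matchings (dropColumn (col a) Rest) k)
    ≡⟨ cong (matchings Rest (suc k) +_) (+-comm S _) ⟩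
  matchings Rest (suc k) + sumOver (map col (a ∷ A)) (λ c → matchings (dropColumn c Rest) k) ∎
  where
  open ≡-Reasoning
  S = sumOver (map col A) (λ c → matchings (dropColumn c Rest) k)
  sameRow : ∀ {b} → b ∈ A → ¬ T (disjointRC a b)
  sameRow b∈ compatible rewrite inRow (here refl) | inRow (there b∈) | ≡ᵇ-true (refl {x = x}) = compatible
  offRowOfA : ∀ z → z ∈ Rest → disjointRC a z ≡ not (col z ≡ᵇ col a)
  offRowOfA z z∈ rewrite inRow (here refl) | ≡ᵇ-false (offRow z∈ ∘ sym) = cong not (≡ᵇ-sym (col a) (col z))
  compatible-a : compatibleWith a (A ++ Rest) ≡ dropColumn (col a) Rest
  compatible-a = begin
    compatibleWith a (A ++ Rest)                  ≡⟨ filter-++ _ A Rest ⟩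
    compatibleWith a A ++ compatibleWith a Rest   ≡⟨ cong (_++ _) (filter-none _ (All.tabulate sameRow)) ⟩
    compatibleWith a Rest                         ≡⟨ filterᵇ-cong Rest offRowOfA ⟩
    dropColumn (col a) Rest ∎

-- L satisfies the rook recurrence with respect to a board R obtained by
-- removing a line of n cells that covers all columns (or rows) of R.
record RookStep (L : List Cell) (n : ℕ) (R : List Cell) : Set where
  constructor rookStep
  field
    recurrence : ∀ k → matchings L (suc k) ≡ matchings R (suc k) + (n ∸ k) * matchings R k

open RookStep

rookStep-row : ∀ x {L A Rest} → L ↭ A ++ Rest →
  (∀ {a} → a ∈ A → row a ≡ x) → (∀ {z} → z ∈ Rest → ¬ row z ≡ x) →
  Unique (map col A) → (∀ {z} → z ∈ Rest → col z ∈ map col A) → RookStep L (length A) Rest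
rookStep-row x {L} {A} {Rest} L↭ inRow offRow uCols covered = rookStep λ k → begin
  matchings L (suc k)
    ≡⟨ matchings-↭ L↭ (suc k) ⟩
  matchings (A ++ Rest) (suc k)
    ≡⟨ matchings-peelRow x A Rest k inRow offRow ⟩
  matchings Rest (suc k) + sumOver (map col A) (λ c → matchings (dropColumn c Rest) k)
    ≡⟨ cong (matchings Rest (suc k) +_) (sumOver-dropColumn (map col A) Rest k uCols covered) ⟩
  matchings Rest (suc k) + (length (map col A) ∸ k) * matchings Rest k
    ≡⟨ cong (λ n → matchings Rest (suc k) + (n ∸ k) * matchings Rest k) (length-map col A) ⟩
  matchings Rest (suc k) + (length A ∸ k) * matchings Rest k ∎
  where open ≡-Reasoning

rookStep-cong : ∀ {L L' n n' R R'} → (∀ k → matchings L k ≡ matchings L' k) → n ≡ n' →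
  (∀ k → matchings R k ≡ matchings R' k) → RookStep L n R → RookStep L' n' R'
rookStep-cong sameL refl sameR step = rookStep λ k →
  trans (sym (sameL (suc k)))
        (trans (recurrence step k) (cong₂ (λ a b → a + (_ ∸ k) * b) (sameR (suc k)) (sameR k)))

rookStep-determines : ∀ {L L' n n' R R'} → RookStep L n R → RookStep L' n' R' → n ≡ n' →
  (∀ k → matchings R k ≡ matchings R' k) → ∀ k → matchings L k ≡ matchings L' k
rookStep-determines {L} {L'} step step' sameLine sameR zero = matchings-zero-eq L L'
rookStep-determines step step' refl sameR (suc k) =
  trans (recurrence step k)
        (trans (cong₂ (λ a b → a + (_ ∸ k) * b) (sameR (suc k)) (sameR k)) (sym (recurrence step' k)))

InFrame : ℕ → ℕ → Cell → Set
InFrame ℓ r z = 1 ≤ row z × row z ≤ ℓ × 1 ≤ col z × col z ≤ r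

∈-range⁻ : ∀ n {b} → b ∈ range n → 1 ≤ b × b ≤ n
∈-range⁻ (suc n) b∈ with ∈-++⁻ (range n) b∈
... | inj₁ b∈′ = proj₁ (∈-range⁻ n b∈′) , m≤n⇒m≤1+n (proj₂ (∈-range⁻ n b∈′))
... | inj₂ (here refl) = s≤s z≤n , ≤-refl

∈-range⁺ : ∀ n {b} → 1 ≤ b → b ≤ n → b ∈ range n
∈-range⁺ zero (s≤s _) ()
∈-range⁺ (suc n) {b} 1≤b b≤1+n with b ≟ suc n
... | yes refl = ∈-++⁺ʳ (range n) (here refl)
... | no b≢1+n = ∈-++⁺ˡ (∈-range⁺ n 1≤b (≤-pred (≤∧≢⇒< b≤1+n b≢1+n)))

unique-range : ∀ n → Unique (range n)
unique-range zero = AllPairs.[]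
unique-range (suc n) = ++⁺ (unique-range n) (All.[] AllPairs.∷ AllPairs.[])
  λ { (b∈ , here refl) → 1+n≰n (proj₂ (∈-range⁻ n b∈)) }

rowCells : ℕ → ℕ → List Cell
rowCells r a = map (λ b → (a , b)) (range r)

rowsCells : ℕ → List ℕ → List Cell
rowsCells r as = concatMap (rowCells r) as

∈-rowsCells⁻ : ∀ r {as z} → z ∈ rowsCells r as → row z ∈ as × 1 ≤ col z × col z ≤ r
∈-rowsCells⁻ r z∈ with find (∈-concatMap⁻ (rowCells r) z∈)
... | a , a∈ , z∈row with ∈-map⁻ (λ b → (a , b)) z∈row
... | b , b∈ , refl = a∈ , ∈-range⁻ r b∈

∈-rowsCells⁺ : ∀ r {as z} → row z ∈ as → 1 ≤ col z → col z ≤ r → z ∈ rowsCells r as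
∈-rowsCells⁺ r a∈ 1≤b b≤r =
  ∈-concatMap⁺ (rowCells r) (lose a∈ (∈-map⁺ (λ b → (_ , b)) (∈-range⁺ r 1≤b b≤r)))

unique-rowsCells : ∀ r {as} → Unique as → Unique (rowsCells r as)
unique-rowsCells r AllPairs.[] = AllPairs.[]
unique-rowsCells r {a ∷ as} (a∉as AllPairs.∷ u) =
  ++⁺ (Unique.map⁺ (cong col) (unique-range r)) (unique-rowsCells r u)
  λ { (z∈row , z∈rest) → All.lookup a∉as (proj₁ (∈-rowsCells⁻ r z∈rest)) (sym (rowOf z∈row)) }
  where
  rowOf : ∀ {z} → z ∈ rowCells r a → row z ≡ a
  rowOf z∈ with ∈-map⁻ (λ b → (a , b)) z∈
  ... | _ , _ , refl = refl

IsCell : ℕ → ℕ → Cells → Cell → Set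
IsCell ℓ r C z = C (row z) (col z) ≡ true × InFrame ℓ r z

∈-cellList : ∀ ℓ r C {z} → z ∈ cellList ℓ r C ⇔ IsCell ℓ r C z
∈-cellList ℓ r C = mk⇔
  (λ z∈ → let z∈frame , isC = ∈-filter⁻ (T? ∘ cellAt) z∈
              a∈ , inCols = ∈-rowsCells⁻ r z∈frame
          in Equivalence.to T-≡ isC , ∈-range⁻ ℓ a∈ .proj₁ , ∈-range⁻ ℓ a∈ .proj₂ , inCols)
  (λ (isC , 1≤a , a≤ℓ , 1≤b , b≤r) →
     ∈-filter⁺ (T? ∘ cellAt) (∈-rowsCells⁺ r (∈-range⁺ ℓ 1≤a a≤ℓ) 1≤b b≤r) (Equivalence.from T-≡ isC))
  where
  cellAt : Cell → Bool
  cellAt z = C (row z) (col z)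

unique-cellList : ∀ ℓ r C → Unique (cellList ℓ r C)
unique-cellList ℓ r C = filter⁺ _ (unique-rowsCells r (unique-range ℓ))

quadrant : ℕ → ℕ → Cells → ℕ → ℕ → List Cell
quadrant ℓ r C x y = filter (λ z → (x ≤? row z) ×-dec (y ≤? col z)) (cellList ℓ r C)

InQuadrant : ℕ → ℕ → Cells → ℕ → ℕ → Cell → Set
InQuadrant ℓ r C x y z = IsCell ℓ r C z × x ≤ row z × y ≤ col z

∈-quadrant : ∀ ℓ r C x y {z} → z ∈ quadrant ℓ r C x y ⇔ InQuadrant ℓ r C x y z
∈-quadrant ℓ r C x y = mk⇔
  (λ z∈ → let z∈C , bounds = ∈-filter⁻ (λ z → (x ≤? row z) ×-dec (y ≤? col z)) z∈
          in Equivalence.to (∈-cellList ℓ r C) z∈C , bounds)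
  (λ (isC , bounds) → ∈-filter⁺ (λ z → (x ≤? row z) ×-dec (y ≤? col z))
                                 (Equivalence.from (∈-cellList ℓ r C) isC) bounds)

unique-quadrant : ∀ ℓ r C x y → Unique (quadrant ℓ r C x y)
unique-quadrant ℓ r C x y = filter⁺ _ (unique-cellList ℓ r C)

matchings-quadrant₁₁ : ∀ ℓ r C k → matchings (cellList ℓ r C) k ≡ matchings (quadrant ℓ r C 1 1) k
matchings-quadrant₁₁ ℓ r C = matchings-sameElements (unique-cellList ℓ r C) (unique-quadrant ℓ r C 1 1)
  (mk⇔ (λ z∈ → let isC@(_ , 1≤a , _ , 1≤b , _) = Equivalence.to (∈-cellList ℓ r C) z∈
               in Equivalence.from (∈-quadrant ℓ r C 1 1) (isC , 1≤a , 1≤b))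
       (λ z∈ → Equivalence.from (∈-cellList ℓ r C) (proj₁ (Equivalence.to (∈-quadrant ℓ r C 1 1) z∈))))

upClosed* : ∀ {ℓ r C} → IsYoung ℓ r C → ∀ {x a b} → 1 ≤ x → x ≤ a → C a b ≡ true → C x b ≡ true
upClosed* {C = C} Y {suc x} {a} {b} _ x≤a = go (≤⇒≤′ x≤a)
  where
  go : ∀ {a} → suc x ≤′ a → C a b ≡ true → C (suc x) b ≡ true
  go ≤′-refl isC = isC
  go (≤′-step {suc a} x≤′a) isC = go x≤′a (IsYoung.upClosed Y a b isC)
  go (≤′-step {zero} (≤′-reflexive ()))

topRow : ℕ → ℕ → Cells → ℕ → ℕ → List Cell
topRow ℓ r C x y = filter (λ z → row z ≟ x) (quadrant ℓ r C x y)

-- Removing the top row of a quadrant of a Young diagram: every cell below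
-- it has a cell of the top row above it, so the top row covers all
-- columns of the rest, which is the next quadrant.
rookStep-topRow : ∀ {ℓ r C} → IsYoung ℓ r C → ∀ {x} y → 1 ≤ x →
  RookStep (quadrant ℓ r C x y) (length (topRow ℓ r C x y)) (quadrant ℓ r C (suc x) y)
rookStep-topRow {ℓ} {r} {C} Y {x} y 1≤x =
  rookStep-cong (λ _ → refl) refl
    (matchings-sameElements (filter⁺ _ (unique-quadrant ℓ r C x y)) (unique-quadrant ℓ r C (suc x) y)
      (mk⇔ toNext fromNext))
    (rookStep-row x (↭-partition (λ z → row z ≟ x) Q) inRow offRow uCols covered)
  where
  Q = quadrant ℓ r C x y
  Rest = filter (¬? ∘ λ z → row z ≟ x) Q
  inRow : ∀ {a} → a ∈ topRow ℓ r C x y → row a ≡ x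
  inRow = proj₂ ∘ ∈-filter⁻ (λ z → row z ≟ x) {xs = Q}
  offRow : ∀ {z} → z ∈ Rest → ¬ row z ≡ x
  offRow = proj₂ ∘ ∈-filter⁻ (¬? ∘ λ z → row z ≟ x) {xs = Q}
  uCols : Unique (map col (topRow ℓ r C x y))
  uCols = unique-map col (λ a∈ b∈ sameCol → cong₂ _,_ (trans (inRow a∈) (sym (inRow b∈))) sameCol)
                         (filter⁺ _ (unique-quadrant ℓ r C x y))
  toNext : ∀ {z} → z ∈ Rest → z ∈ quadrant ℓ r C (suc x) y
  toNext z∈ with ∈-filter⁻ (¬? ∘ λ z → row z ≟ x) {xs = Q} z∈
  ... | z∈Q , row≢x with Equivalence.to (∈-quadrant ℓ r C x y) z∈Q
  ... | isC , x≤a , y≤b =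
    Equivalence.from (∈-quadrant ℓ r C (suc x) y) (isC , ≤∧≢⇒< x≤a (row≢x ∘ sym) , y≤b)
  fromNext : ∀ {z} → z ∈ quadrant ℓ r C (suc x) y → z ∈ Rest
  fromNext z∈ with Equivalence.to (∈-quadrant ℓ r C (suc x) y) z∈
  ... | isC , x<a , y≤b =
    ∈-filter⁺ (¬? ∘ λ z → row z ≟ x)
      (Equivalence.from (∈-quadrant ℓ r C x y) (isC , <⇒≤ x<a , y≤b)) (λ a≡x → <⇒≢ x<a (sym a≡x))
  -- the cell (x , b) above a cell (a , b) of the rest lies in the top row
  covered : ∀ {z} → z ∈ Rest → col z ∈ map col (topRow ℓ r C x y)
  covered z∈ with Equivalence.to (∈-quadrant ℓ r C x y) (proj₁ (∈-filter⁻ (¬? ∘ λ z → row z ≟ x) {xs = Q} z∈))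
  ... | (isC , _ , a≤ℓ , 1≤b , b≤r) , x≤a , y≤b =
    ∈-map⁺ col (∈-filter⁺ (λ z → row z ≟ x)
      (Equivalence.from (∈-quadrant ℓ r C x y)
        ((upClosed* Y 1≤x x≤a isC , 1≤x , ≤-trans x≤a a≤ℓ , 1≤b , b≤r) , ≤-refl , y≤b))
      refl)

_ᵀ : Cells → Cells
(C ᵀ) a b = C b a

young-ᵀ : ∀ {ℓ r C} → IsYoung ℓ r C → IsYoung r ℓ (C ᵀ)
young-ᵀ Y = record
  { inFrame = λ a b isC → let 1≤b , b≤ℓ , 1≤a , a≤r = IsYoung.inFrame Y b a isC in 1≤a , a≤r , 1≤b , b≤ℓ
  ; upClosed = λ a b → IsYoung.leftClosed Y b a
  ; leftClosed = λ a b → IsYoung.upClosed Y b a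
  }

disjointRC-swap : ∀ z w → disjointRC (swap z) (swap w) ≡ disjointRC z w
disjointRC-swap z w = ∧-comm (not (col z ≡ᵇ col w)) _

quadrant-ᵀ : ∀ ℓ r C x y → map swap (quadrant ℓ r C x y) ↭ quadrant r ℓ (C ᵀ) y x
quadrant-ᵀ ℓ r C x y = sameElements⇒↭
  (Unique.map⁺ (cong swap) (unique-quadrant ℓ r C x y)) (unique-quadrant r ℓ (C ᵀ) y x)
  (mk⇔ to (λ z∈ → ∈-map⁺ swap (Equivalence.from (∈-quadrant ℓ r C x y)
                                   (mirror {r} {ℓ} {C ᵀ} (Equivalence.to (∈-quadrant r ℓ (C ᵀ) y x) z∈)))))
  where
  mirror : ∀ {ℓ r C x y z} → InQuadrant ℓ r C x y z → InQuadrant r ℓ (C ᵀ) y x (swap z)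
  mirror ((isC , 1≤a , a≤ℓ , 1≤b , b≤r) , x≤a , y≤b) = (isC , 1≤b , b≤r , 1≤a , a≤ℓ) , y≤b , x≤a
  to : ∀ {z} → z ∈ map swap (quadrant ℓ r C x y) → z ∈ quadrant r ℓ (C ᵀ) y x
  to z∈ with ∈-map⁻ swap z∈
  ... | w , w∈ , refl =
    Equivalence.from (∈-quadrant r ℓ (C ᵀ) y x) (mirror {ℓ} {r} {C} (Equivalence.to (∈-quadrant ℓ r C x y) w∈))

matchings-quadrant-ᵀ : ∀ ℓ r C x y k → matchings (quadrant ℓ r C x y) k ≡ matchings (quadrant r ℓ (C ᵀ) y x) k
matchings-quadrant-ᵀ ℓ r C x y k =
  trans (sym (matchings-map swap (quadrant ℓ r C x y) (λ {z} {w} _ _ → disjointRC-swap z w) k))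
        (matchings-↭ (quadrant-ᵀ ℓ r C x y) k)

leftColumn : ℕ → ℕ → Cells → ℕ → ℕ → List Cell
leftColumn ℓ r C x y = filter (λ z → col z ≟ y) (quadrant ℓ r C x y)

length-leftColumn : ∀ ℓ r C x y → length (leftColumn ℓ r C x y) ≡ length (topRow r ℓ (C ᵀ) y x)
length-leftColumn ℓ r C x y = begin
  length (leftColumn ℓ r C x y)                         ≡⟨ sym (length-map swap (leftColumn ℓ r C x y)) ⟩
  length (map swap (leftColumn ℓ r C x y))              ≡⟨ cong length (sym (filter-map onRow swap (quadrant ℓ r C x y))) ⟩
  length (filter onRow (map swap (quadrant ℓ r C x y))) ≡⟨ ↭-length (filter-↭ onRow (quadrant-ᵀ ℓ r C x y)) ⟩
  length (topRow r ℓ (C ᵀ) y x) ∎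
  where
  open ≡-Reasoning
  onRow : Decidable (λ z → row z ≡ y)
  onRow z = row z ≟ y

-- Removing the first column of a quadrant is removing the first row of the
-- mirrored quadrant of Cᵀ.
rookStep-leftColumn : ∀ {ℓ r C} → IsYoung ℓ r C → ∀ x {y} → 1 ≤ y →
  RookStep (quadrant ℓ r C x y) (length (leftColumn ℓ r C x y)) (quadrant ℓ r C x (suc y))
rookStep-leftColumn {ℓ} {r} {C} Y x {y} 1≤y =
  rookStep-cong (sym ∘ matchings-quadrant-ᵀ ℓ r C x y) (sym (length-leftColumn ℓ r C x y))
                (sym ∘ matchings-quadrant-ᵀ ℓ r C x (suc y))
                (rookStep-topRow (young-ᵀ Y) x 1≤y)

length-filter-agree : ∀ {ℓ r C C' x y} {P : Cell → Set} (P? : Decidable P) →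
  (∀ {z} → P z → C (row z) (col z) ≡ C' (row z) (col z)) →
  length (filter P? (quadrant ℓ r C x y)) ≡ length (filter P? (quadrant ℓ r C' x y))
length-filter-agree {ℓ} {r} {C} {C'} {x} {y} {P} P? agree =
  ↭-length (sameElements⇒↭ (filter⁺ P? (unique-quadrant ℓ r C x y)) (filter⁺ P? (unique-quadrant ℓ r C' x y))
    (mk⇔ (transfer agree) (transfer (sym ∘ agree))))
  where
  transfer : ∀ {D D'} → (∀ {z} → P z → D (row z) (col z) ≡ D' (row z) (col z)) →
    ∀ {z} → z ∈ filter P? (quadrant ℓ r D x y) → z ∈ filter P? (quadrant ℓ r D' x y)
  transfer {D} {D'} same z∈ with ∈-filter⁻ P? {xs = quadrant ℓ r D x y} z∈
  ... | z∈Q , Pz with Equivalence.to (∈-quadrant ℓ r D x y) z∈Q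
  ... | (isD , frame) , bounds =
    ∈-filter⁺ P? (Equivalence.from (∈-quadrant ℓ r D' x y) ((trans (sym (same Pz)) isD , frame) , bounds)) Pz

translate : ℕ → ℕ → ℕ → ℕ
translate n m a = a ∸ n + m

translate-back : ∀ {n} m {a} → n ≤ a → translate m n (translate n m a) ≡ a
translate-back {n} m {a} n≤a = trans (cong (_+ n) (m+n∸n≡m (a ∸ n) m)) (m∸n+n≡m n≤a)

translate-injective : ∀ {n} m {a b} → n ≤ a → n ≤ b → translate n m a ≡ translate n m b → a ≡ b
translate-injective m n≤a n≤b e =
  trans (sym (translate-back m n≤a)) (trans (cong (translate m _) e) (translate-back m n≤b))

module TransposeAt {ℓ r B} (YB : IsYoung ℓ r B) (i j : ℕ) (legal : LegalTranspose ℓ r B i j) where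

  B* : Cells
  B* = transposeAt B i j

  B*-above : ∀ {a} b → a < i → B* a b ≡ B a b
  B*-above {a} b a<i rewrite <ᵇ-true a<i = trans (∨-identityʳ _) (∧-identityʳ _)

  B*-left : ∀ a {b} → b < j → B* a b ≡ B a b
  B*-left a {b} b<j rewrite <ᵇ-true b<j | ∨-zeroʳ (a <ᵇ i) | ∧-zeroʳ (not (a <ᵇ i)) =
    trans (∨-identityʳ _) (∧-identityʳ _)

  reflect : Cell → Cell
  reflect z = (translate j i (col z) , translate i j (row z))

  InCorner : Cell → Set
  InCorner z = i ≤ row z × j ≤ col z

  B*-corner : ∀ {a b} → InCorner (a , b) → B* a b ≡ B (translate j i b) (translate i j a)
  B*-corner {a} {b} (i≤a , j≤b) rewrite <ᵇ-false i≤a | <ᵇ-false j≤b | ∧-zeroʳ (B a b) = refl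

  inCorner : ∀ C {z} → z ∈ quadrant ℓ r C i j → InCorner z
  inCorner C z∈ = proj₂ (Equivalence.to (∈-quadrant ℓ r C i j) z∈)

  reflect-corner : ∀ z → InCorner (reflect z)
  reflect-corner z = m≤n+m i _ , m≤n+m j _

  reflect-involutive : ∀ {z} → InCorner z → reflect (reflect z) ≡ z
  reflect-involutive (i≤a , j≤b) = cong₂ _,_ (translate-back j i≤a) (translate-back i j≤b)

  reflect-disjointRC : ∀ {z w} → InCorner z → InCorner w → disjointRC (reflect z) (reflect w) ≡ disjointRC z w
  reflect-disjointRC {z} {w} (i≤a , j≤b) (i≤c , j≤d) =
    trans (cong₂ (λ s t → not s ∧ not t)
             (≡ᵇ-injective (translate j i) (translate-injective i j≤b j≤d))
             (≡ᵇ-injective (translate i j) (translate-injective j i≤a i≤c)))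
          (∧-comm (not (col z ≡ᵇ col w)) _)

  corner-reflect : map reflect (quadrant ℓ r B i j) ↭ quadrant ℓ r B* i j
  corner-reflect = sameElements⇒↭
    (unique-map reflect reflect-injective (unique-quadrant ℓ r B i j)) (unique-quadrant ℓ r B* i j)
    (mk⇔ to from)
    where
    reflect-injective : ∀ {z w} → z ∈ quadrant ℓ r B i j → w ∈ quadrant ℓ r B i j → reflect z ≡ reflect w → z ≡ w
    reflect-injective z∈ w∈ e =
      trans (sym (reflect-involutive (inCorner B z∈))) (trans (cong reflect e) (reflect-involutive (inCorner B w∈)))
    to : ∀ {z} → z ∈ map reflect (quadrant ℓ r B i j) → z ∈ quadrant ℓ r B* i j
    to z∈ with ∈-map⁻ reflect z∈
    ... | w , w∈ , refl with Equivalence.to (∈-quadrant ℓ r B i j) w∈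
    ... | (isB , _) , i≤a , j≤b =
      Equivalence.from (∈-quadrant ℓ r B* i j) ((isB* , IsYoung.inFrame legal _ _ isB*) , reflect-corner w)
      where
      isB* : B* (row (reflect w)) (col (reflect w)) ≡ true
      isB* = trans (B*-corner (reflect-corner w)) (trans (cong₂ B (translate-back j i≤a) (translate-back i j≤b)) isB)
    from : ∀ {z} → z ∈ quadrant ℓ r B* i j → z ∈ map reflect (quadrant ℓ r B i j)
    from {z} z∈ with Equivalence.to (∈-quadrant ℓ r B* i j) z∈
    ... | (isB* , _) , z∈corner =
      subst (_∈ map reflect (quadrant ℓ r B i j)) (reflect-involutive z∈corner)
        (∈-map⁺ reflect (Equivalence.from (∈-quadrant ℓ r B i j) ((isB , IsYoung.inFrame YB _ _ isB) , reflect-corner z)))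
      where
      isB : B (row (reflect z)) (col (reflect z)) ≡ true
      isB = trans (sym (B*-corner z∈corner)) isB*

  -- The reflection preserves disjointness, so the corners have equal counts.
  matchings-corner : ∀ k → matchings (quadrant ℓ r B i j) k ≡ matchings (quadrant ℓ r B* i j) k
  matchings-corner k =
    trans (sym (matchings-map reflect (quadrant ℓ r B i j)
                 (λ z∈ w∈ → reflect-disjointRC (inCorner B z∈) (inCorner B w∈)) k))
          (matchings-↭ corner-reflect k)

  -- Removing the columns y = j - 1, …, 1 from the rows ≥ i: B and B*
  -- agree on these columns, so the rook recurrences match.
  matchings-columns : ∀ y → 1 ≤ y → y ≤ j →
    ∀ k → matchings (quadrant ℓ r B i y) k ≡ matchings (quadrant ℓ r B* i y) k
  matchings-columns = downwardInduction _ j matchings-corner λ y 1≤y y<j same →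
    rookStep-determines (rookStep-leftColumn YB i 1≤y) (rookStep-leftColumn legal i 1≤y)
      (length-filter-agree {ℓ} {r} {B} {B*} {i} {y} (λ z → col z ≟ y)
         λ {z} col≡y → sym (B*-left (row z) (subst (_< j) (sym col≡y) y<j)))
      same

  -- Removing the rows x = i - 1, …, 1, on which B and B* agree.
  matchings-rows : 1 ≤ j → ∀ x → 1 ≤ x → x ≤ i →
    ∀ k → matchings (quadrant ℓ r B x 1) k ≡ matchings (quadrant ℓ r B* x 1) k
  matchings-rows 1≤j = downwardInduction _ i (matchings-columns 1 ≤-refl 1≤j) λ x 1≤x x<i same →
    rookStep-determines (rookStep-topRow YB 1 1≤x) (rookStep-topRow legal 1 1≤x)
      (length-filter-agree {ℓ} {r} {B} {B*} {x} {1} (λ z → row z ≟ x)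
         λ {z} row≡x → sym (B*-above (col z) (subst (_< i) (sym row≡x) x<i)))
      same

lemma3p4 : (ℓ r : ℕ) (B : Cells) → IsYoung ℓ r B →
    (i j : ℕ) → B i j ≡ true → LegalTranspose ℓ r B i j →
    (k : ℕ) → matchCount ℓ r (transposeAt B i j) k ≡ matchCount ℓ r B k
lemma3p4 ℓ r B YB i j Bij legal k = begin
  matchCount ℓ r B* k                ≡⟨ matchings-quadrant₁₁ ℓ r B* k ⟩
  matchings (quadrant ℓ r B* 1 1) k  ≡⟨ sym (matchings-rows 1≤j 1 ≤-refl 1≤i k) ⟩
  matchings (quadrant ℓ r B 1 1) k   ≡⟨ sym (matchings-quadrant₁₁ ℓ r B k) ⟩
  matchCount ℓ r B k ∎
  where
  open ≡-Reasoning
  open TransposeAt YB i j legal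
  1≤i : 1 ≤ i
  1≤i = proj₁ (IsYoung.inFrame YB i j Bij)
  1≤j : 1 ≤ j
  1≤j = proj₁ (proj₂ (proj₂ (IsYoung.inFrame YB i j Bij)))
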